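{- Let $n,k$ be positive integers and let $f$ be a valid $(n,k)$-code. Then $w(\phi_{\leftarrow}(f))=w(f)=w(\phi_{\rightarrow}(f))$.
   Context: An $(n,k)$-code is a function $f:\{1,\dots,n\}\to\mathbb{Z}_{\ge 0}$ with $\sum_i f(i)=k$; write $f_i=f(i)$ and index positions cyclically in $\mathbb{Z}_n$. A cyclic interval $[i,j]$ is $\{i,i+1,\dots,j\}$ taken in $\mathbb{Z}_n$. Let $m_f=\max_{i\in\mathbb{Z}_n}(f_i+f_{i+1})$. The code is invalid if $f_i+f_{i+1}=m_f$ for all $i$, valid otherwise. A slime of $f$ is a cyclic interval $[i,j]$ of size $l$ with $2\le l\le n$ such that $f_r+f_{r+1}=m_f$ for $r=i,\dots,j-1$, while $f_{i-1}+f_i<m_f$ and $f_j+f_{j+1}<m_f$. The weight of a slime of size $l$ is $\lfloor l/2\rfloor$, and the weight $w(f)$ of the code is the sum of the weights of all its slimes. Forward move on a slime $[i,j]$ of size $l$: if $l$ is even, subtract $1$ at positions $i,i+2,\dots,j-1$ and add $1$ at positions $i+1,\dots,j$; if $l$ is odd, leave position $i$ unchanged, subtract $1$ at positions $i+1,i+3,\dots,j-1$ and add $1$ at positions $i+2,\dots,j$. Backward move: if $l$ is even, add $1$ at positions $i,i+2,\dots,j-1$ and subtract $1$ at positions $i+1,\dots,j$; if $l$ is odd, add $1$ at positions $i,i+2,\dots,j-2$, subtract $1$ at positions $i+1,\dots,j-1$, leave position $j$ unchanged. $\phi_{\rightarrow}(f)$ (resp. $\phi_{\leftarrow}(f)$)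 is obtained from $f$ by performing the forward (resp. backward) move on all slimes of $f$ simultaneously. -}

module Defs where

open import Data.Bool using (Bool; true; false; _∧_; if_then_else_)
open import Data.Nat as ℕ using (ℕ; zero; suc; NonZero; _∸_; _/_; _%_; _<ᵇ_; _≤ᵇ_; _≡ᵇ_)
open import Data.Nat.DivMod using (_mod_)
open import Data.Fin using (Fin; toℕ)
open import Data.Fin.Properties using () renaming (_≟_ to _≟ᶠ_)
open import Data.Integer as ℤ using (ℤ; +_; _-_)
open import Data.Integer.Properties using () renaming (_≟_ to _≟ℤ_; _<?_ to _<ℤ?_)
open import Data.List using (List; []; _∷_; map; foldr; allFin; upTo)
open import Data.Nat.ListAction using (sum)
open import Relation.Nullary using (does; ¬_)
open import Relation.Binary.PropositionalEquality using (_≡_)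

total : ∀ {n} → (Fin n → ℕ) → ℕ
total {n} f = sum (map f (allFin n))

IsCode : (n k : ℕ) → (Fin n → ℕ) → Set
IsCode n k f = total f ≡ k

-- Integer-valued configurations (the moves add/subtract 1).
Conf : ℕ → Set
Conf n = Fin n → ℤ

toConf : ∀ {n} → (Fin n → ℕ) → Conf n
toConf f i = + (f i)

sumℤ : List ℤ → ℤ
sumℤ = foldr ℤ._+_ (+ 0)

pos : ∀ {n} .{{_ : NonZero n}} → Fin n → ℕ → Fin n
pos {n} i t = (toℕ i ℕ.+ t) mod n

prev : ∀ {n} .{{_ : NonZero n}} → Fin n → Fin n
prev {n} i = pos i (n ∸ 1)

pairSum : ∀ {n} .{{_ : NonZero n}} → Conf n → Fin n → ℤ
pairSum f i = f i ℤ.+ f (pos i 1)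

maxPair : ∀ {n} .{{_ : NonZero n}} → Conf n → ℤ
maxPair {n} f = foldr ℤ._⊔_ (pairSum f (0 mod n)) (map (pairSum f) (allFin n))

Invalid : ∀ {n} .{{_ : NonZero n}} → Conf n → Set
Invalid f = ∀ i → pairSum f i ≡ maxPair f

Valid : ∀ {n} .{{_ : NonZero n}} → Conf n → Set
Valid f = ¬ Invalid f

allB : List Bool → Bool
allB = foldr _∧_ true

isSlime : ∀ {n} .{{_ : NonZero n}} → Conf n → Fin n → ℕ → Bool
isSlime {n} f i l =
  (2 ≤ᵇ l) ∧ (l ≤ᵇ n)
  ∧ allB (map (λ r → does (pairSum f (pos i r) ≟ℤ maxPair f)) (upTo (l ∸ 1)))
  ∧ does (pairSum f (prev i) <ℤ? maxPair f)
  ∧ does (pairSum f (pos i (l ∸ 1)) <ℤ? maxPair f)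

-- all slimes, as (start, size) pairs; size ranges over 0..n, start over ℤ_n
-- (distinct pairs give distinct cyclic intervals)
slimeSum : ∀ {n} .{{_ : NonZero n}} → Conf n → (Fin n → ℕ → ℕ) → ℕ
slimeSum {n} f g =
  sum (map (λ i → sum (map (λ l → if isSlime f i l then g i l else 0) (upTo (suc n)))) (allFin n))

slimeSumℤ : ∀ {n} .{{_ : NonZero n}} → Conf n → (Fin n → ℕ → ℤ) → ℤ
slimeSumℤ {n} f g =
  sumℤ (map (λ i → sumℤ (map (λ l → if isSlime f i l then g i l else + 0) (upTo (suc n)))) (allFin n))

weight : ∀ {n} .{{_ : NonZero n}} → Conf n → ℕ
weight f = slimeSum f (λ _ l → l / 2)

even : ℕ → Bool
even t = t % 2 ≡ᵇ 0

-- change at offset t (0 ≤ t < l) inside a slime of size l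
fwdCoeff : ℕ → ℕ → ℤ
fwdCoeff l t =
  if even l
  then (if even t then ℤ.- (+ 1) else + 1)
  else (if t ≡ᵇ 0 then + 0 else (if even t then + 1 else ℤ.- (+ 1)))

bwdCoeff : ℕ → ℕ → ℤ
bwdCoeff l t =
  if even l
  then (if even t then + 1 else ℤ.- (+ 1))
  else (if t ≡ᵇ (l ∸ 1) then + 0 else (if even t then + 1 else ℤ.- (+ 1)))

delta : ∀ {n} .{{_ : NonZero n}} → (ℕ → ℕ → ℤ) → Conf n → Fin n → ℤ
delta coeff f p =
  slimeSumℤ f (λ i l → sumℤ (map (λ t → if does (pos i t ≟ᶠ p) then coeff l t else + 0) (upTo l)))

φ→ : ∀ {n} .{{_ : NonZero n}} → Conf n → Conf n
φ→ f p = f p ℤ.+ delta fwdCoeff f p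

φ← : ∀ {n} .{{_ : NonZero n}} → Conf n → Conf n
φ← f p = f p ℤ.+ delta bwdCoeff f p

module Submission where

-- Let m be the maximal pair sum. Validity gives a pair below m, so the slimes are exactly the
-- maximal runs of pairs equal to m, each starting right after a pair below m. Both moves add to
-- each slime an alternating ±1 pattern whose consecutive sums cancel, so a pair-by-pair check
-- shows that all new pair sums stay ≤ m and that m is still attained. Under φ→ an even slime keeps
-- its start, an odd one loses its first pair, and either may absorb one more pair at its end;
-- under φ← an even slime keeps its end, an odd one loses its last pair, and either may absorb one
-- more pair before its start. So a slime of size l becomes one of size l or l + 1 (l even) or
-- l − 1 or l (l odd), of the same weight ⌊l/2⌋, and summing over starting points, reindexed along
-- a rotation of ℤ_n for the slimes whose start moved, gives the equalities.

open import Algebra.Bundles using (Monoid)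
open import Data.Bool using (Bool; true; false; not; if_then_else_)
open import Data.Bool.Properties using (∧-conicalˡ; ∧-conicalʳ; ¬-not; not-injective; not-involutive; T-≡)
open import Data.Empty using (⊥-elim)
open import Data.Fin as Fin using (Fin; toℕ; inject₁; fromℕ)
open import Data.Fin.Properties using (toℕ-injective; toℕ-fromℕ<; toℕ<n; toℕ-inject₁; toℕ-fromℕ; ¬∀⟶∃¬)
  renaming (suc-injective to Fin-suc-injective; _≟_ to _≟ᶠ_)
open import Data.Integer as ℤ using (ℤ; 0ℤ; 1ℤ; -1ℤ)
import Data.Integer.Properties as ℤP
open import Data.List using (List; []; _∷_; map; foldr; allFin; upTo; applyUpTo; tabulate)
open import Data.List.Membership.Propositional using (_∈_)
open import Data.List.Membership.Propositional.Properties using (∈-allFin; ∈-map⁺; ∈-map⁻)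
open import Data.List.Properties using (map-cong; map-tabulate; tabulate-cong)
open import Data.List.Relation.Unary.Any using (here; there)
open import Data.Nat as ℕ using (ℕ; zero; suc; NonZero; _∸_; _+_; _*_; _%_; _/_; _≤_; _<_; z≤n; s≤s; _≡ᵇ_)
open import Data.Nat.DivMod
open import Data.Nat.ListAction using (sum)
open import Data.Nat.Properties
open import Data.Product using (∃; _×_; _,_; proj₁; proj₂)
open import Data.Sum using (_⊎_; inj₁; inj₂; [_,_]; [_,_]′)
open import Function using (id; _∘′_; Equivalence)
open import Relation.Binary.Definitions using (tri<; tri≈; tri>)
open import Relation.Binary.PropositionalEquality hiding ([_])
open import Relation.Nullary using (¬_; Dec; yes; no; does)
open import Relation.Nullary.Decidable using (dec-true; dec-false)

open import Algebra.Properties.CommutativeSemigroup +-commutativeSemigroup using ()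
  renaming (interchange to +-interchange)
open import Algebra.Properties.CommutativeSemigroup ℤP.+-commutativeSemigroup using ()
  renaming (interchange to ℤ-interchange)

open import Defs

module CyclicPositions (n : ℕ) .{{_ : NonZero n}} where

  next : Fin n → Fin n
  next i = pos i 1

  prev^ : Fin n → ℕ → Fin n
  prev^ x zero    = x
  prev^ x (suc k) = prev^ (prev x) k

  toℕ-pos : ∀ i t → toℕ (pos i t) ≡ (toℕ i + t) % n
  toℕ-pos i t = toℕ-fromℕ< (m%n<n (toℕ i + t) n)

  private
    1≤n : 1 ≤ n
    1≤n = ℕ.>-nonZero⁻¹ n

    toℕ%n≡toℕ : ∀ (i : Fin n) → toℕ i % n ≡ toℕ i
    toℕ%n≡toℕ i = m<n⇒m%n≡m (toℕ<n i)

    [m%n+k]%n≡[m+k]%n : ∀ m k → (m % n + k) % n ≡ (m + k) % n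
    [m%n+k]%n≡[m+k]%n m k = begin
      (m % n + k) % n           ≡⟨ %-distribˡ-+ (m % n) k n ⟩
      (m % n % n + k % n) % n   ≡⟨ cong (λ z → (z + k % n) % n) (m%n%n≡m%n m n) ⟩
      (m % n + k % n) % n       ≡⟨ %-distribˡ-+ m k n ⟨
      (m + k) % n               ∎
      where open ≡-Reasoning

  pos-+ : ∀ i a b → pos (pos i a) b ≡ pos i (a + b)
  pos-+ i a b = toℕ-injective (begin
    toℕ (pos (pos i a) b)      ≡⟨ toℕ-pos (pos i a) b ⟩
    (toℕ (pos i a) + b) % n    ≡⟨ cong (λ z → (z + b) % n) (toℕ-pos i a) ⟩
    ((toℕ i + a) % n + b) % n  ≡⟨ [m%n+k]%n≡[m+k]%n (toℕ i + a) b ⟩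
    (toℕ i + a + b) % n        ≡⟨ cong (_% n) (+-assoc (toℕ i) a b) ⟩
    (toℕ i + (a + b)) % n      ≡⟨ toℕ-pos i (a + b) ⟨
    toℕ (pos i (a + b))        ∎)
    where open ≡-Reasoning

  pos-0 : ∀ i → pos i 0 ≡ i
  pos-0 i = toℕ-injective (trans (toℕ-pos i 0) (trans (cong (_% n) (+-identityʳ (toℕ i))) (toℕ%n≡toℕ i)))

  pos-*n : ∀ i k → pos i (k * n) ≡ i
  pos-*n i k = toℕ-injective (trans (toℕ-pos i (k * n)) (trans ([m+kn]%n≡m%n (toℕ i) k n) (toℕ%n≡toℕ i)))

  pos-n : ∀ i → pos i n ≡ i
  pos-n i = trans (cong (pos i) (sym (+-identityʳ n))) (pos-*n i 1)

  pos-cancelʳ : ∀ {x y} b → pos x b ≡ pos y b → x ≡ y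
  pos-cancelʳ {x} {y} b e = begin
    x                          ≡⟨ pos-*n x b ⟨
    pos x (b * n)              ≡⟨ cong (pos x) b+c≡bn ⟨
    pos x (b + c)              ≡⟨ pos-+ x b c ⟨
    pos (pos x b) c            ≡⟨ cong (λ z → pos z c) e ⟩
    pos (pos y b) c            ≡⟨ pos-+ y b c ⟩
    pos y (b + c)              ≡⟨ cong (pos y) b+c≡bn ⟩
    pos y (b * n)              ≡⟨ pos-*n y b ⟩
    y                          ∎
    where
      open ≡-Reasoning
      c = b * n ∸ b
      b+c≡bn : b + c ≡ b * n
      b+c≡bn = m+[n∸m]≡n (m≤m*n b n)

  pos-fixed⇒0 : ∀ y d → d < n → pos y d ≡ y → d ≡ 0
  pos-fixed⇒0 y d d<n e with ≤-<-connex n (toℕ y + d)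
  ... | inj₂ y+d<n = +-cancelˡ-≡ (toℕ y) d 0 (begin
    toℕ y + d                  ≡⟨ m<n⇒m%n≡m y+d<n ⟨
    (toℕ y + d) % n            ≡⟨ trans (sym (toℕ-pos y d)) (cong toℕ e) ⟩
    toℕ y                      ≡⟨ +-identityʳ (toℕ y) ⟨
    toℕ y + 0                  ∎)
    where open ≡-Reasoning
  ... | inj₁ n≤y+d = ⊥-elim (<⇒≢ d<n (+-cancelˡ-≡ (toℕ y) d n (begin
    toℕ y + d                  ≡⟨ m∸n+n≡m n≤y+d ⟨
    toℕ y + d ∸ n + n          ≡⟨ cong (_+ n) wrapped ⟩
    toℕ y + n                  ∎)))
    where
      open ≡-Reasoning
      y+d∸n<n : toℕ y + d ∸ n < n
      y+d∸n<n = +-cancelʳ-< n _ n (subst (_< n + n) (sym (m∸n+n≡m n≤y+d)) (+-mono-< (toℕ<n y) d<n))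
      wrapped : toℕ y + d ∸ n ≡ toℕ y
      wrapped = begin
        toℕ y + d ∸ n          ≡⟨ m<n⇒m%n≡m y+d∸n<n ⟨
        (toℕ y + d ∸ n) % n    ≡⟨ m≤n⇒[n∸m]%m≡n%m n≤y+d ⟩
        (toℕ y + d) % n        ≡⟨ toℕ-pos y d ⟨
        toℕ (pos y d)          ≡⟨ cong toℕ e ⟩
        toℕ y                  ∎

  private
    pos-injective-≤ : ∀ i {a b} → a ≤ b → b < n → pos i a ≡ pos i b → a ≡ b
    pos-injective-≤ i {a} {b} a≤b b<n e = begin
      a                  ≡⟨ +-identityʳ a ⟨
      a + 0              ≡⟨ cong (a +_) b∸a≡0 ⟨
      a + (b ∸ a)        ≡⟨ m+[n∸m]≡n a≤b ⟩
      b                  ∎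
      where
        open ≡-Reasoning
        b∸a≡0 : b ∸ a ≡ 0
        b∸a≡0 = pos-fixed⇒0 (pos i a) (b ∸ a) (≤-<-trans (m∸n≤m b a) b<n)
                  (trans (pos-+ i a (b ∸ a)) (trans (cong (pos i) (m+[n∸m]≡n a≤b)) (sym e)))

  pos-injective : ∀ i {a b} → a < n → b < n → pos i a ≡ pos i b → a ≡ b
  pos-injective i {a} {b} a<n b<n e with ≤-total a b
  ... | inj₁ a≤b = pos-injective-≤ i a≤b b<n e
  ... | inj₂ b≤a = sym (pos-injective-≤ i b≤a a<n (sym e))

  pos-surjective : ∀ i q → ∃ λ d → d < n × pos i d ≡ q
  pos-surjective i q = d , m%n<n _ n , toℕ-injective (begin
    toℕ (pos i d)                           ≡⟨ toℕ-pos i d ⟩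
    (toℕ i + d) % n                         ≡⟨ cong (_% n) (+-comm (toℕ i) d) ⟩
    (d + toℕ i) % n                         ≡⟨ [m%n+k]%n≡[m+k]%n (toℕ q + (n ∸ toℕ i)) (toℕ i) ⟩
    (toℕ q + (n ∸ toℕ i) + toℕ i) % n       ≡⟨ cong (_% n) (+-assoc (toℕ q) _ (toℕ i)) ⟩
    (toℕ q + (n ∸ toℕ i + toℕ i)) % n       ≡⟨ cong (λ z → (toℕ q + z) % n) (m∸n+n≡m (<⇒≤ (toℕ<n i))) ⟩
    (toℕ q + n) % n                         ≡⟨ [m+n]%n≡m%n (toℕ q) n ⟩
    toℕ q % n                               ≡⟨ toℕ%n≡toℕ q ⟩
    toℕ q                                   ∎)
    where
      open ≡-Reasoning
      d = (toℕ q + (n ∸ toℕ i)) % n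

  pos-suc : ∀ i k → pos i (suc k) ≡ pos (next i) k
  pos-suc i k = sym (pos-+ i 1 k)

  pos-sucʳ : ∀ i k → pos i (suc k) ≡ next (pos i k)
  pos-sucʳ i k = trans (cong (pos i) (+-comm 1 k)) (sym (pos-+ i k 1))

  prev-pos-suc : ∀ i k → prev (pos i (suc k)) ≡ pos i k
  prev-pos-suc i k = begin
    pos (pos i (suc k)) (n ∸ 1)  ≡⟨ pos-+ i (suc k) (n ∸ 1) ⟩
    pos i (suc k + (n ∸ 1))      ≡⟨ cong (pos i) (trans (cong suc (+-comm k (n ∸ 1))) (trans (cong (_+ k) (m+[n∸m]≡n 1≤n)) (+-comm n k))) ⟩
    pos i (k + n)                ≡⟨ pos-+ i k n ⟨
    pos (pos i k) n              ≡⟨ pos-n (pos i k) ⟩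
    pos i k                      ∎
    where open ≡-Reasoning

  prev-next : ∀ i → prev (next i) ≡ i
  prev-next i = trans (prev-pos-suc i 0) (pos-0 i)

  next-prev : ∀ i → next (prev i) ≡ i
  next-prev i = trans (pos-+ i (n ∸ 1) 1) (trans (cong (pos i) (trans (+-comm (n ∸ 1) 1) (m+[n∸m]≡n 1≤n))) (pos-n i))

  prev^-pos : ∀ q k → prev^ (pos q k) k ≡ q
  prev^-pos q zero    = pos-0 q
  prev^-pos q (suc k) = trans (cong (λ z → prev^ z k) (prev-pos-suc q k)) (prev^-pos q k)

  next-prev^-prev : ∀ x k → next (prev^ (prev x) k) ≡ prev^ x k
  next-prev^-prev x zero    = next-prev x
  next-prev^-prev x (suc k) = next-prev^-prev (prev x) k

  pos-prev^-+ : ∀ x k j → pos (prev^ x (j + k)) j ≡ prev^ x k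
  pos-prev^-+ x k zero    = pos-0 _
  pos-prev^-+ x k (suc j) =
    trans (pos-sucʳ _ j) (trans (cong next (pos-prev^-+ (prev x) k j)) (next-prev^-prev x k))

  pos-prev^ : ∀ x k → pos (prev^ x k) k ≡ x
  pos-prev^ x k = trans (cong (λ z → pos (prev^ x z) k) (sym (+-identityʳ k))) (pos-prev^-+ x 0 k)

  prev^-prev : ∀ x k → prev^ (prev x) k ≡ prev (prev^ x k)
  prev^-prev x zero    = refl
  prev^-prev x (suc k) = prev^-prev (prev x) k

module MonoidSums {c ℓ} (M : Monoid c ℓ) where
  open Monoid M renaming (refl to ≈-refl; trans to ≈-trans)

  ∑ : List Carrier → Carrier
  ∑ = foldr _∙_ ε

  ∑-applyUpTo-ε : ∀ {A : Set} (G : A → Carrier) h m →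
    (∀ j → j < m → G (h j) ≈ ε) → ∑ (map G (applyUpTo h m)) ≈ ε
  ∑-applyUpTo-ε G h zero    z = ≈-refl
  ∑-applyUpTo-ε G h (suc m) z =
    ≈-trans (∙-cong (z 0 (s≤s z≤n)) (∑-applyUpTo-ε G (h ∘′ suc) m (λ j j<m → z (suc j) (s≤s j<m)))) (identityˡ ε)

  ∑-applyUpTo-single : ∀ {A : Set} (G : A → Carrier) h m j₀ → j₀ < m →
    (∀ j → j < m → j ≢ j₀ → G (h j) ≈ ε) → ∑ (map G (applyUpTo h m)) ≈ G (h j₀)
  ∑-applyUpTo-single G h (suc m) zero _ z =
    ≈-trans (∙-congˡ (∑-applyUpTo-ε G (h ∘′ suc) m (λ j j<m → z (suc j) (s≤s j<m) λ ()))) (identityʳ _)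
  ∑-applyUpTo-single G h (suc m) (suc j₀) (s≤s j₀<m) z =
    ≈-trans (∙-cong (z 0 (s≤s z≤n) λ ())
                  (∑-applyUpTo-single G (h ∘′ suc) m j₀ j₀<m (λ j j<m j≢j₀ → z (suc j) (s≤s j<m) (j≢j₀ ∘′ suc-injective))))
          (identityˡ _)

  ∑-tabulate-ε : ∀ {A : Set} (G : A → Carrier) m (h : Fin m → A) →
    (∀ j → G (h j) ≈ ε) → ∑ (map G (tabulate h)) ≈ ε
  ∑-tabulate-ε G zero    h z = ≈-refl
  ∑-tabulate-ε G (suc m) h z = ≈-trans (∙-cong (z Fin.zero) (∑-tabulate-ε G m (h ∘′ Fin.suc) (λ j → z (Fin.suc j)))) (identityˡ ε)

  ∑-tabulate-single : ∀ {A : Set} (G : A → Carrier) m (h : Fin m → A) j₀ →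
    (∀ j → j ≢ j₀ → G (h j) ≈ ε) → ∑ (map G (tabulate h)) ≈ G (h j₀)
  ∑-tabulate-single G (suc m) h Fin.zero z =
    ≈-trans (∙-congˡ (∑-tabulate-ε G m (h ∘′ Fin.suc) (λ j → z (Fin.suc j) λ ()))) (identityʳ _)
  ∑-tabulate-single G (suc m) h (Fin.suc j₀) z =
    ≈-trans (∙-cong (z Fin.zero λ ()) (∑-tabulate-single G m (h ∘′ Fin.suc) j₀ (λ j j≢j₀ → z (Fin.suc j) (j≢j₀ ∘′ Fin-suc-injective))))
          (identityˡ _)

open MonoidSums ℤP.+-0-monoid
  renaming (∑-applyUpTo-ε to sumℤ-upTo-0; ∑-applyUpTo-single to sumℤ-upTo-single;
            ∑-tabulate-ε to sumℤ-allFin-0; ∑-tabulate-single to sumℤ-allFin-single)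
  using ()

sum-map-+ : ∀ {A : Set} (F G : A → ℕ) xs → sum (map (λ x → F x + G x) xs) ≡ sum (map F xs) + sum (map G xs)
sum-map-+ F G []       = refl
sum-map-+ F G (x ∷ xs) = trans (cong (F x + G x +_) (sum-map-+ F G xs)) (+-interchange (F x) (G x) _ _)

sum-tabulate-last : ∀ {A : Set} (G : A → ℕ) m (h : Fin (suc m) → A) →
  sum (map G (tabulate h)) ≡ sum (map G (tabulate (h ∘′ inject₁))) + G (h (fromℕ m))
sum-tabulate-last G zero    h = +-identityʳ _
sum-tabulate-last G (suc m) h =
  trans (cong (G (h Fin.zero) +_) (sum-tabulate-last G m (h ∘′ Fin.suc))) (sym (+-assoc (G (h Fin.zero)) _ _))

sum-allFin-next : ∀ n .{{_ : NonZero n}} (F : Fin n → ℕ) →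
  sum (map (F ∘′ CyclicPositions.next n) (allFin n)) ≡ sum (map F (allFin n))
sum-allFin-next (suc m) F = begin
  sum (map (F ∘′ next) (allFin (suc m)))                        ≡⟨ sum-tabulate-last (F ∘′ next) m id ⟩
  sum (map (F ∘′ next) (tabulate inject₁)) + F (next (fromℕ m)) ≡⟨ cong₂ _+_ (cong sum shift) (cong F next-last) ⟩
  sum (map F (tabulate Fin.suc)) + F Fin.zero                   ≡⟨ +-comm _ (F Fin.zero) ⟩
  sum (map F (allFin (suc m)))                                  ∎
  where
    open ≡-Reasoning
    open CyclicPositions (suc m)
    next-inject₁ : ∀ j → next (inject₁ j) ≡ Fin.suc j
    next-inject₁ j = toℕ-injective (trans (toℕ-pos (inject₁ j) 1)
      (trans (cong (λ z → (z + 1) % suc m) (toℕ-inject₁ j)) (trans (cong (_% suc m) (+-comm (toℕ j) 1)) (m<n⇒m%n≡m (s≤s (toℕ<n j))))))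
    shift : map (F ∘′ next) (tabulate inject₁) ≡ map F (tabulate Fin.suc)
    shift = trans (map-tabulate inject₁ (F ∘′ next)) (trans (tabulate-cong (λ j → cong F (next-inject₁ j))) (sym (map-tabulate Fin.suc F)))
    next-last : next (fromℕ m) ≡ Fin.zero
    next-last = toℕ-injective (trans (toℕ-pos (fromℕ m) 1)
      (trans (cong (λ z → (z + 1) % suc m) (toℕ-fromℕ m)) (trans (cong (_% suc m) (+-comm m 1)) (n%n≡0 (suc m)))))

sum-allFin-prev : ∀ n .{{_ : NonZero n}} (F : Fin n → ℕ) → sum (map (F ∘′ prev) (allFin n)) ≡ sum (map F (allFin n))
sum-allFin-prev n F = trans (sym (sum-allFin-next n (F ∘′ prev))) (cong sum (map-cong (λ j → cong F (prev-next j)) (allFin n)))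
  where open CyclicPositions n

sum-allFin-reindex : ∀ n (σ : Fin n → Fin n) → (∀ F → sum (map (F ∘′ σ) (allFin n)) ≡ sum (map F (allFin n))) →
  ∀ (X Y : Fin n → ℕ) → sum (map (λ i → X i + Y (σ i)) (allFin n)) ≡ sum (map (λ i → X i + Y i) (allFin n))
sum-allFin-reindex n σ invariant X Y = begin
  sum (map (λ i → X i + Y (σ i)) (allFin n))           ≡⟨ sum-map-+ X (Y ∘′ σ) (allFin n) ⟩
  sum (map X (allFin n)) + sum (map (Y ∘′ σ) (allFin n)) ≡⟨ cong (sum (map X (allFin n)) +_) (invariant Y) ⟩
  sum (map X (allFin n)) + sum (map Y (allFin n))      ≡⟨ sum-map-+ X Y (allFin n) ⟨
  sum (map (λ i → X i + Y i) (allFin n))               ∎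
  where open ≡-Reasoning

private
  bounded-search : (P : ℕ → Set) → (∀ k → Dec (P k)) → ∀ e →
    (∃ λ k → k ≤ e × P k × (∀ j → j < k → ¬ P j)) ⊎ (∀ j → j ≤ e → ¬ P j)
  bounded-search P P? zero with P? 0
  ... | yes p = inj₁ (0 , z≤n , p , λ _ ())
  ... | no ¬p = inj₂ λ { .zero z≤n → ¬p }
  bounded-search P P? (suc e) with bounded-search P P? e
  ... | inj₁ (k , k≤e , pk , below) = inj₁ (k , m≤n⇒m≤1+n k≤e , pk , below)
  ... | inj₂ none with P? (suc e)
  ...   | yes p = inj₁ (suc e , ≤-refl , p , λ j j<1+e → none j (≤-pred j<1+e))
  ...   | no ¬p = inj₂ λ j j≤1+e → [ (λ j<1+e → none j (≤-pred j<1+e)) , (λ { refl → ¬p }) ] (m≤n⇒m<n∨m≡n j≤1+e)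

least-witness : (P : ℕ → Set) → (∀ k → Dec (P k)) → ∀ e → P e → ∃ λ k → k ≤ e × P k × (∀ j → j < k → ¬ P j)
least-witness P P? e pe with bounded-search P P? e
... | inj₁ w    = w
... | inj₂ none = ⊥-elim (none e ≤-refl pe)

≡-<-absurd : ∀ {x y : ℤ} → x ≡ y → x ℤ.< y → ∀ {A : Set} → A
≡-<-absurd x≡y x<y = ⊥-elim (ℤP.<-irrefl x≡y x<y)

foldr-⊔-upperBound : ∀ d (xs : List ℤ) {x} → x ∈ xs → x ℤ.≤ foldr ℤ._⊔_ d xs
foldr-⊔-upperBound d (y ∷ xs) (here refl) = ℤP.i≤i⊔j y _
foldr-⊔-upperBound d (y ∷ xs) (there x∈xs) = ℤP.≤-trans (foldr-⊔-upperBound d xs x∈xs) (ℤP.i≤j⊔i y _)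

foldr-⊔-sel : ∀ d (xs : List ℤ) → foldr ℤ._⊔_ d xs ≡ d ⊎ foldr ℤ._⊔_ d xs ∈ xs
foldr-⊔-sel d []       = inj₁ refl
foldr-⊔-sel d (y ∷ xs) with ℤP.⊔-sel y (foldr ℤ._⊔_ d xs) | foldr-⊔-sel d xs
... | inj₁ y⊔m≡y | _              = inj₂ (here y⊔m≡y)
... | inj₂ y⊔m≡m | inj₁ m≡d       = inj₁ (trans y⊔m≡m m≡d)
... | inj₂ y⊔m≡m | inj₂ m∈xs      = inj₂ (there (subst (_∈ xs) (sym y⊔m≡m) m∈xs))

allB-applyUpTo⁺ : ∀ (P : ℕ → Bool) h m → (∀ j → j < m → P (h j) ≡ true) → allB (map P (applyUpTo h m)) ≡ true
allB-applyUpTo⁺ P h zero    all = refl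
allB-applyUpTo⁺ P h (suc m) all rewrite all 0 (s≤s z≤n) = allB-applyUpTo⁺ P (h ∘′ suc) m (λ j j<m → all (suc j) (s≤s j<m))

allB-applyUpTo⁻ : ∀ (P : ℕ → Bool) h m → allB (map P (applyUpTo h m)) ≡ true → ∀ j → j < m → P (h j) ≡ true
allB-applyUpTo⁻ P h (suc m) all zero    _          = ∧-conicalˡ _ _ all
allB-applyUpTo⁻ P h (suc m) all (suc j) (s≤s j<m) = allB-applyUpTo⁻ P (h ∘′ suc) m (∧-conicalʳ _ _ all) j j<m

does-true⇒ : ∀ {A : Set} (A? : Dec A) → does A? ≡ true → A
does-true⇒ (yes a) _ = a

module Slimes (n : ℕ) .{{_ : NonZero n}} where
  open CyclicPositions n

  AtMax BelowMax : Conf n → Fin n → Set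
  AtMax    h r = pairSum h r ≡ maxPair h
  BelowMax h r = pairSum h r ℤ.< maxPair h

  pairSum≤maxPair : ∀ h r → pairSum h r ℤ.≤ maxPair h
  pairSum≤maxPair h r = foldr-⊔-upperBound _ _ (∈-map⁺ (pairSum h) (∈-allFin r))

  maxPair-attained : ∀ h → ∃ (AtMax h)
  maxPair-attained h with foldr-⊔-sel (pairSum h (0 mod n)) (map (pairSum h) (allFin n))
  ... | inj₁ m≡d  = 0 mod n , sym m≡d
  ... | inj₂ m∈xs with ∈-map⁻ (pairSum h) m∈xs
  ...   | r , _ , m≡p = r , sym m≡p

  atMax⊎belowMax : ∀ h r → AtMax h r ⊎ BelowMax h r
  atMax⊎belowMax h r with pairSum h r ℤP.≟ maxPair h
  ... | yes p≡m = inj₁ p≡m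
  ... | no  p≢m = inj₂ (ℤP.≤∧≢⇒< (pairSum≤maxPair h r) p≢m)

  ¬atMax⇒belowMax : ∀ h {r} → ¬ AtMax h r → BelowMax h r
  ¬atMax⇒belowMax h {r} ¬at with atMax⊎belowMax h r
  ... | inj₁ at    = ⊥-elim (¬at at)
  ... | inj₂ below = below

  ¬belowMax⇒atMax : ∀ h {r} → ¬ BelowMax h r → AtMax h r
  ¬belowMax⇒atMax h {r} ¬below with atMax⊎belowMax h r
  ... | inj₁ at    = at
  ... | inj₂ below = ⊥-elim (¬below below)

  maxPair-unique : ∀ h K → (∀ r → pairSum h r ℤ.≤ K) → ∀ r₀ → pairSum h r₀ ≡ K → maxPair h ≡ K
  maxPair-unique h K ≤K r₀ p≡K with maxPair-attained h
  ... | r , at = ℤP.≤-antisym (subst (ℤ._≤ K) at (≤K r)) (subst (ℤ._≤ maxPair h) p≡K (pairSum≤maxPair h r₀))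

  record Slime (h : Conf n) (i : Fin n) (l : ℕ) : Set where
    field
      2≤l    : 2 ≤ l
      l≤n    : l ≤ n
      inside : ∀ r → r < l ∸ 1 → AtMax h (pos i r)
      before : BelowMax h (prev i)
      after  : BelowMax h (pos i (l ∸ 1))

  isSlime-complete : ∀ {h i l} → Slime h i l → isSlime h i l ≡ true
  isSlime-complete {h} {i} {l} s
    rewrite dec-true (2 ≤? l) (Slime.2≤l s) | dec-true (l ≤? n) (Slime.l≤n s)
          | allB-applyUpTo⁺ (λ r → does (pairSum h (pos i r) ℤP.≟ maxPair h)) id (l ∸ 1)
              (λ r r< → dec-true (pairSum h (pos i r) ℤP.≟ maxPair h) (Slime.inside s r r<))
          | dec-true (pairSum h (prev i) ℤP.<? maxPair h) (Slime.before s)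
          | dec-true (pairSum h (pos i (l ∸ 1)) ℤP.<? maxPair h) (Slime.after s) = refl

  isSlime-sound : ∀ {h i l} → isSlime h i l ≡ true → Slime h i l
  isSlime-sound {h} {i} {l} e = record
    { 2≤l    = ≤ᵇ⇒≤ 2 l (Equivalence.from T-≡ (∧-conicalˡ b₁ _ e))
    ; l≤n    = ≤ᵇ⇒≤ l n (Equivalence.from T-≡ (∧-conicalˡ b₂ _ e₂))
    ; inside = λ r r< → does-true⇒ (pairSum h (pos i r) ℤP.≟ maxPair h)
                          (allB-applyUpTo⁻ P id (l ∸ 1) (∧-conicalˡ b₃ _ e₃) r r<)
    ; before = does-true⇒ (pairSum h (prev i) ℤP.<? maxPair h) (∧-conicalˡ b₄ _ e₄)
    ; after  = does-true⇒ (pairSum h (pos i (l ∸ 1)) ℤP.<? maxPair h) (∧-conicalʳ b₄ _ e₄)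
    }
    where
      P  = λ r → does (pairSum h (pos i r) ℤP.≟ maxPair h)
      b₁ = 2 ℕ.≤ᵇ l
      b₂ = l ℕ.≤ᵇ n
      b₃ = allB (map P (upTo (l ∸ 1)))
      b₄ = does (pairSum h (prev i) ℤP.<? maxPair h)
      e₂ = ∧-conicalʳ b₁ _ e
      e₃ = ∧-conicalʳ b₂ _ e₂
      e₄ = ∧-conicalʳ b₃ _ e₃

  record Run (h : Conf n) (i : Fin n) (k : ℕ) : Set where
    field
      k<n    : k < n
      inside : ∀ j → j < k → AtMax h (pos i j)
      end    : BelowMax h (pos i k)

  isSlime⇒size : ∀ {h i k l} → Run h i k → isSlime h i l ≡ true → l ≡ suc k
  isSlime⇒size {h} {i} {k} {l} run e with isSlime-sound {h} {i} {l} e | <-cmp (l ∸ 1) k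
  ... | s | tri< l-1<k _ _ = ≡-<-absurd (Run.inside run (l ∸ 1) l-1<k) (Slime.after s)
  ... | s | tri> _ _ k<l-1 = ≡-<-absurd (Slime.inside s k k<l-1) (Run.end run)
  ... | s | tri≈ _ l-1≡k _ = trans (sym (m∸n+n≡m (≤-trans (s≤s z≤n) (Slime.2≤l s)))) (trans (cong (_+ 1) l-1≡k) (+-comm k 1))

  run⇒isSlime : ∀ {h i k} → Run h i k → BelowMax h (prev i) → 1 ≤ k → isSlime h i (suc k) ≡ true
  run⇒isSlime {h} {i} {k} run before 1≤k = isSlime-complete {h} {i} {suc k} (record
    { 2≤l = s≤s 1≤k ; l≤n = Run.k<n run ; inside = Run.inside run ; before = before ; after = Run.end run })

  NotStart : Conf n → Fin n → Set
  NotStart h i = AtMax h (prev i) ⊎ BelowMax h i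

  atMax⇒notStart-next : ∀ h i → AtMax h i → NotStart h (next i)
  atMax⇒notStart-next h i at = inj₁ (subst (AtMax h) (sym (prev-next i)) at)

  notStart⇒¬isSlime : ∀ {h i} l → NotStart h i → isSlime h i l ≡ false
  notStart⇒¬isSlime {h} {i} l (inj₁ prevAtMax) = ¬-not λ e → ≡-<-absurd prevAtMax (Slime.before (isSlime-sound {h} {i} {l} e))
  notStart⇒¬isSlime {h} {i} l (inj₂ below) = ¬-not λ e →
    let s = isSlime-sound {h} {i} {l} e in
    ≡-<-absurd (subst (AtMax h) (pos-0 i) (Slime.inside s 0 (≤-trans (s≤s z≤n) (∸-monoˡ-≤ 1 (Slime.2≤l s))))) below

  module SlimeSums {c ℓ} (M : Monoid c ℓ) where
    open Monoid M renaming (refl to ≈-refl; trans to ≈-trans)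
    open MonoidSums M

    -- weight h unfolds to the sum over i of slimesAtℕ h i (_/ 2), and delta c h q to the sum of
    -- slimesAtℤ h i (moveAt c q i) with moveAt as in SlimeDecomposition.
    slimesAt : Conf n → Fin n → (ℕ → Carrier) → Carrier
    slimesAt h i V = ∑ (map (λ l → if isSlime h i l then V l else ε) (upTo (suc n)))

    slimesAt-run : ∀ {h i k} → Run h i k → BelowMax h (prev i) → 1 ≤ k → ∀ V → slimesAt h i V ≈ V (suc k)
    slimesAt-run {h} {i} {k} run before 1≤k V =
      ≈-trans (∑-applyUpTo-single G id (suc n) (suc k) (s≤s (Run.k<n run)) others)
              (reflexive (cong (λ b → if b then V (suc k) else ε) (run⇒isSlime run before 1≤k)))
      where
        G = λ l → if isSlime h i l then V l else ε
        others : ∀ j → j < suc n → j ≢ suc k → G j ≈ ε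
        others j _ j≢1+k with isSlime h i j in e
        ... | true  = ⊥-elim (j≢1+k (isSlime⇒size run e))
        ... | false = ≈-refl

    slimesAt-notStart : ∀ h i → NotStart h i → ∀ V → slimesAt h i V ≈ ε
    slimesAt-notStart h i ns V = ∑-applyUpTo-ε (λ l → if isSlime h i l then V l else ε) id (suc n)
      (λ l _ → reflexive (cong (λ b → if b then V l else ε) (notStart⇒¬isSlime {h} {i} l ns)))

  open SlimeSums +-0-monoid public
    renaming (slimesAt to slimesAtℕ; slimesAt-run to slimesAtℕ-run; slimesAt-notStart to slimesAtℕ-notStart)
  open SlimeSums ℤP.+-0-monoid public
    renaming (slimesAt to slimesAtℤ; slimesAt-run to slimesAtℤ-run; slimesAt-notStart to slimesAtℤ-notStart)

  slimesAtℕ-split : ∀ h i (V X Y : ℕ → ℕ) → (∀ l → V l ≡ X l + Y l) →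
    slimesAtℕ h i V ≡ slimesAtℕ h i X + slimesAtℕ h i Y
  slimesAtℕ-split h i V X Y V≡X+Y = trans (cong sum (map-cong split (upTo (suc n))))
    (sum-map-+ (λ l → if isSlime h i l then X l else 0) (λ l → if isSlime h i l then Y l else 0) (upTo (suc n)))
    where
      split : ∀ l → (if isSlime h i l then V l else 0) ≡ (if isSlime h i l then X l else 0) + (if isSlime h i l then Y l else 0)
      split l with isSlime h i l
      ... | true  = V≡X+Y l
      ... | false = refl

even-suc-suc : ∀ t → even (suc (suc t)) ≡ even t
even-suc-suc t = cong (_≡ᵇ 0) (trans (cong (_% 2) (+-comm 2 t)) ([m+n]%n≡m%n t 2))

even-suc : ∀ t → even (suc t) ≡ not (even t)
even-suc zero    = refl
even-suc (suc t) = trans (even-suc-suc t) (sym (trans (cong not (even-suc t)) (not-involutive (even t))))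

even⇒[1+t]/2≡t/2 : ∀ t → even t ≡ true → suc t / 2 ≡ t / 2
even⇒[1+t]/2≡t/2 zero          _ = refl
even⇒[1+t]/2≡t/2 (suc (suc t)) e =
  trans (m/n≡1+[m∸n]/n {suc (suc (suc t))} {2} (s≤s (s≤s z≤n)))
        (trans (cong suc (even⇒[1+t]/2≡t/2 t (trans (sym (even-suc-suc t)) e)))
               (sym (m/n≡1+[m∸n]/n {suc (suc t)} {2} (s≤s (s≤s z≤n)))))

parity : ∀ t → even t ≡ true ⊎ even t ≡ false
parity t with even t
... | true  = inj₁ refl
... | false = inj₂ refl

odd-suc⇒2≤ : ∀ k → even (suc k) ≡ false → 1 ≤ k → 2 ≤ k
odd-suc⇒2≤ (suc (suc k)) _ _ = s≤s (s≤s z≤n)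

even-pred : ∀ k → even (suc k) ≡ false → even k ≡ true
even-pred k e = not-injective (trans (sym (even-suc k)) e)

≢⇒≡ᵇ≡false : ∀ m k → m ≢ k → (m ≡ᵇ k) ≡ false
≢⇒≡ᵇ≡false m k m≢k = ¬-not λ e → m≢k (≡ᵇ⇒≡ m k (Equivalence.from T-≡ e))

x≡m∧d≡0⇒x+d≡m : ∀ {x m d} → x ≡ m → d ≡ 0ℤ → x ℤ.+ d ≡ m
x≡m∧d≡0⇒x+d≡m refl refl = ℤP.+-identityʳ _

x≡m∧d≡-1⇒x+d<m : ∀ {x m d} → x ≡ m → d ≡ -1ℤ → x ℤ.+ d ℤ.< m
x≡m∧d≡-1⇒x+d<m {x} refl refl = subst (x ℤ.+ -1ℤ ℤ.<_) (ℤP.+-identityʳ x) (ℤP.+-monoʳ-< x ℤ.-<+)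

x≡m∧d≤0⇒x+d≤m : ∀ {x m d} → x ≡ m → d ℤ.≤ 0ℤ → x ℤ.+ d ℤ.≤ m
x≡m∧d≤0⇒x+d≤m {x} refl d≤0 = subst (x ℤ.+ _ ℤ.≤_) (ℤP.+-identityʳ x) (ℤP.+-monoʳ-≤ x d≤0)

x<m∧d≤0⇒x+d<m : ∀ {x m d} → x ℤ.< m → d ℤ.≤ 0ℤ → x ℤ.+ d ℤ.< m
x<m∧d≤0⇒x+d<m {x} x<m d≤0 = ℤP.≤-<-trans (x≡m∧d≤0⇒x+d≤m refl d≤0) x<m

x<m∧d≤1⇒x+d≤m : ∀ {x m d} → x ℤ.< m → d ℤ.≤ 1ℤ → x ℤ.+ d ℤ.≤ m
x<m∧d≤1⇒x+d≤m {x} x<m d≤1 = ℤP.≤-trans (ℤP.+-monoʳ-≤ x d≤1) (subst (ℤ._≤ _) (ℤP.+-comm 1ℤ x) (ℤP.i<j⇒suc[i]≤j x<m))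

private
  sign : ℕ → ℤ
  sign t = if even t then 1ℤ else -1ℤ

  sign-cancel : ∀ t → sign t ℤ.+ sign (suc t) ≡ 0ℤ
  sign-cancel t rewrite even-suc t with even t
  ... | true  = refl
  ... | false = refl

fwdCoeff-0-even : ∀ l → even l ≡ true → fwdCoeff l 0 ≡ -1ℤ
fwdCoeff-0-even l e rewrite e = refl

fwdCoeff-0≤0 : ∀ l → fwdCoeff l 0 ℤ.≤ 0ℤ
fwdCoeff-0≤0 l with even l
... | true  = ℤ.-≤+
... | false = ℤP.≤-refl

fwdCoeff-first-even : ∀ l → even l ≡ true → fwdCoeff l 0 ℤ.+ fwdCoeff l 1 ≡ 0ℤ
fwdCoeff-first-even l e rewrite e = refl

fwdCoeff-first-odd : ∀ l → even l ≡ false → fwdCoeff l 0 ℤ.+ fwdCoeff l 1 ≡ -1ℤ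
fwdCoeff-first-odd l e rewrite e = refl

fwdCoeff-cancel : ∀ l t → fwdCoeff l (suc t) ℤ.+ fwdCoeff l (suc (suc t)) ≡ 0ℤ
fwdCoeff-cancel l t rewrite even-suc (suc t) with even l | even (suc t)
... | true  | true  = refl
... | true  | false = refl
... | false | true  = refl
... | false | false = refl

fwdCoeff-pair≤0 : ∀ l t → fwdCoeff l t ℤ.+ fwdCoeff l (suc t) ℤ.≤ 0ℤ
fwdCoeff-pair≤0 l (suc t) = ℤP.≤-reflexive (fwdCoeff-cancel l t)
fwdCoeff-pair≤0 l zero with even l
... | true  = ℤP.≤-refl
... | false = ℤ.-≤+

fwdCoeff-last : ∀ k → 1 ≤ k → fwdCoeff (suc k) k ≡ 1ℤ
fwdCoeff-last (suc k) _ rewrite even-suc (suc k) with even (suc k)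
... | true  = refl
... | false = refl

private
  bwdCoeff-even : ∀ l t → even l ≡ true → bwdCoeff l t ≡ sign t
  bwdCoeff-even l t e rewrite e = refl

  bwdCoeff-odd : ∀ l t → even l ≡ false → t ≢ l ∸ 1 → bwdCoeff l t ≡ sign t
  bwdCoeff-odd l t e t≢l-1 rewrite e | ≢⇒≡ᵇ≡false t (l ∸ 1) t≢l-1 = refl

bwdCoeff-0 : ∀ k → 1 ≤ k → bwdCoeff (suc k) 0 ≡ 1ℤ
bwdCoeff-0 (suc k) _ with even (suc (suc k))
... | true  = refl
... | false = refl

bwdCoeff-last-even : ∀ k → even (suc k) ≡ true → bwdCoeff (suc k) k ≡ -1ℤ
bwdCoeff-last-even k e = trans (bwdCoeff-even (suc k) k e)
  (cong (λ b → if b then 1ℤ else -1ℤ) (trans (sym (not-involutive (even k))) (cong not (trans (sym (even-suc k)) e))))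

bwdCoeff-last-odd : ∀ k → even (suc k) ≡ false → bwdCoeff (suc k) k ≡ 0ℤ
bwdCoeff-last-odd k e rewrite e | Equivalence.to T-≡ (≡⇒≡ᵇ k k refl) = refl

bwdCoeff-last≤0 : ∀ k → bwdCoeff (suc k) k ℤ.≤ 0ℤ
bwdCoeff-last≤0 k with parity (suc k)
... | inj₁ e = ℤP.≤-trans (ℤP.≤-reflexive (bwdCoeff-last-even k e)) ℤ.-≤+
... | inj₂ e = ℤP.≤-reflexive (bwdCoeff-last-odd k e)

bwdCoeff-cancel : ∀ k t → suc t < k ⊎ even (suc k) ≡ true → bwdCoeff (suc k) t ℤ.+ bwdCoeff (suc k) (suc t) ≡ 0ℤ
bwdCoeff-cancel k t c with parity (suc k) | c
... | inj₁ e | _ = trans (cong₂ ℤ._+_ (bwdCoeff-even (suc k) t e) (bwdCoeff-even (suc k) (suc t) e)) (sign-cancel t)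
... | inj₂ e | inj₁ 1+t<k = trans (cong₂ ℤ._+_ (bwdCoeff-odd (suc k) t e (<⇒≢ (<-trans (n<1+n t) 1+t<k)))
                                              (bwdCoeff-odd (suc k) (suc t) e (<⇒≢ 1+t<k)))
                                  (sign-cancel t)
... | inj₂ e | inj₂ e′ with () ← trans (sym e) e′

bwdCoeff-last-pair-odd : ∀ k → even (suc k) ≡ false → 2 ≤ k → bwdCoeff (suc k) (k ∸ 1) ℤ.+ bwdCoeff (suc k) k ≡ -1ℤ
bwdCoeff-last-pair-odd (suc (suc k)) e _ = cong₂ ℤ._+_
  (trans (bwdCoeff-odd (suc (suc (suc k))) (suc k) e (<⇒≢ (n<1+n (suc k))))
         (cong (λ b → if b then 1ℤ else -1ℤ) (trans (sym (even-suc-suc (suc k))) e)))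
  (bwdCoeff-last-odd (suc (suc k)) e)

bwdCoeff-pair≤0 : ∀ k t → t < k → bwdCoeff (suc k) t ℤ.+ bwdCoeff (suc k) (suc t) ℤ.≤ 0ℤ
bwdCoeff-pair≤0 k t t<k with m≤n⇒m<n∨m≡n t<k
... | inj₁ 1+t<k = ℤP.≤-reflexive (bwdCoeff-cancel k t (inj₁ 1+t<k))
... | inj₂ refl with parity (suc (suc t))
...   | inj₁ e = ℤP.≤-reflexive (bwdCoeff-cancel (suc t) t (inj₂ e))
...   | inj₂ e = last-odd t e
  where
    last-odd : ∀ t → even (suc (suc t)) ≡ false → bwdCoeff (suc (suc t)) t ℤ.+ bwdCoeff (suc (suc t)) (suc t) ℤ.≤ 0ℤ
    last-odd (suc t) e = ℤP.≤-trans (ℤP.≤-reflexive (bwdCoeff-last-pair-odd (suc (suc t)) e (s≤s (s≤s z≤n)))) ℤ.-≤+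

module SlimeDecomposition (n : ℕ) .{{_ : NonZero n}} (f : Conf n)
                          (b : Fin n) (b-below : Slimes.BelowMax n f b) where
  open CyclicPositions n
  open Slimes n

  M : ℤ
  M = maxPair f

  belowMax? : ∀ r → Dec (BelowMax f r)
  belowMax? r = pairSum f r ℤP.<? M

  -- Kept abstract: unfolding the search makes type checking of later goals about run blow up.
  abstract
    run-exists : ∀ i → ∃ (Run f i)
    run-exists i with pos-surjective i b
    ... | d , d<n , i+d≡b with least-witness (λ k → BelowMax f (pos i k)) (λ k → belowMax? (pos i k)) d
                                               (subst (BelowMax f) (sym i+d≡b) b-below)
    ...   | k , k≤d , end , before-k = k , record
      { k<n = ≤-<-trans k≤d d<n ; inside = λ j j<k → ¬belowMax⇒atMax f (before-k j j<k) ; end = end }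

  run : Fin n → ℕ
  run i = proj₁ (run-exists i)

  run-spec : ∀ i → Run f i (run i)
  run-spec i = proj₂ (run-exists i)

  size : Fin n → ℕ
  size i = suc (run i)

  run-atMax : ∀ {i} j → j < run i → AtMax f (pos i j)
  run-atMax {i} = Run.inside (run-spec i)

  run-end : ∀ i → BelowMax f (pos i (run i))
  run-end i = Run.end (run-spec i)

  atMax⇒1≤run : ∀ i → AtMax f i → 1 ≤ run i
  atMax⇒1≤run i at with run i in run≡
  ... | zero  = ≡-<-absurd at (subst (BelowMax f) (pos-0 i) (subst (λ k → BelowMax f (pos i k)) run≡ (run-end i)))
  ... | suc _ = s≤s z≤n

  record IsStart (i : Fin n) : Set where
    constructor mkIsStart
    field
      before : BelowMax f (prev i)
      1≤run  : 1 ≤ run i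

  isStart : ∀ i → BelowMax f (prev i) → AtMax f i → IsStart i
  isStart i before at = mkIsStart before (atMax⇒1≤run i at)

  atMax⇒<run : ∀ {i} j → j ≤ run i → AtMax f (pos i j) → j < run i
  atMax⇒<run {i} j j≤run at with m≤n⇒m<n∨m≡n j≤run
  ... | inj₁ j<run = j<run
  ... | inj₂ refl  = ≡-<-absurd at (run-end i)

  InSlime : Fin n → Set
  InSlime r = ∃ λ i → ∃ λ t → IsStart i × t < run i × pos i t ≡ r

  atMax⇒inSlime : ∀ r → AtMax f r → InSlime r
  atMax⇒inSlime r at with pos-surjective b (prev r)
  ... | e , _ , b+e≡r-1 with least-witness (λ k → BelowMax f (prev^ (prev r) k)) (λ k → belowMax? (prev^ (prev r) k)) e
                             (subst (BelowMax f) (sym (trans (cong (λ z → prev^ z e) (sym b+e≡r-1)) (prev^-pos b e))) b-below)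
  ...   | k , _ , before-i , after-k = i , k , isStart i (subst (BelowMax f) (prev^-prev r k) before-i) (subst (AtMax f) (pos-0 i) (atMax-from-i 0 z≤n)) , k<run , pos-prev^ r k
    where
      i = prev^ r k
      atMax-back : ∀ m → m ≤ k → AtMax f (prev^ r m)
      atMax-back zero    _     = at
      atMax-back (suc m) 1+m≤k = ¬belowMax⇒atMax f (after-k m 1+m≤k)
      atMax-from-i : ∀ j → j ≤ k → AtMax f (pos i j)
      atMax-from-i j j≤k = subst (AtMax f)
        (sym (trans (cong (λ z → pos (prev^ r z) j) (sym (m+[n∸m]≡n j≤k))) (pos-prev^-+ r (k ∸ j) j)))
        (atMax-back (k ∸ j) (m∸n≤m k j))
      k<run : k < run i
      k<run with <-cmp k (run i)
      ... | tri< k<run _ _ = k<run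
      ... | tri≈ _ k≡run _ = ≡-<-absurd (subst (λ z → AtMax f (pos i z)) k≡run (atMax-from-i k ≤-refl)) (run-end i)
      ... | tri> _ _ run<k = ≡-<-absurd (atMax-from-i (run i) (<⇒≤ run<k)) (run-end i)

  private
    start-unique-≤ : ∀ {i i′} t t′ → IsStart i → IsStart i′ → t ≤ t′ → t′ ≤ run i′ → pos i t ≡ pos i′ t′ → i ≡ i′
    start-unique-≤ {i} {i′} t t′ (mkIsStart before _) _ t≤t′ t′≤run e = by-gap (t′ ∸ t) refl
      where
        i≡ : i ≡ pos i′ (t′ ∸ t)
        i≡ = pos-cancelʳ t (trans e (trans (cong (pos i′) (sym (trans (+-comm (t′ ∸ t) t) (m+[n∸m]≡n t≤t′)))) (sym (pos-+ i′ (t′ ∸ t) t))))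
        by-gap : ∀ d → t′ ∸ t ≡ d → i ≡ i′
        by-gap zero    gap = trans i≡ (trans (cong (pos i′) gap) (pos-0 i′))
        by-gap (suc u) gap = ≡-<-absurd
          (subst (AtMax f) (sym (trans (cong prev (trans i≡ (cong (pos i′) gap))) (prev-pos-suc i′ u)))
                 (run-atMax u (<-≤-trans (subst (u <_) (sym gap) ≤-refl) (≤-trans (m∸n≤m t′ t) t′≤run))))
          before

  start-unique : ∀ {i i′} t t′ → IsStart i → IsStart i′ → t ≤ run i → t′ ≤ run i′ → pos i t ≡ pos i′ t′ → i ≡ i′
  start-unique t t′ st st′ t≤ t′≤ e with ≤-total t t′
  ... | inj₁ t≤t′ = start-unique-≤ t t′ st st′ t≤t′ t′≤ e
  ... | inj₂ t′≤t = sym (start-unique-≤ t′ t st′ st t′≤t t≤ (sym e))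

  moveAt : (ℕ → ℕ → ℤ) → Fin n → Fin n → ℕ → ℤ
  moveAt c q i l = sumℤ (map (λ t → if does (pos i t ≟ᶠ q) then c l t else 0ℤ) (upTo l))

  slimesAtℤ-start : ∀ i V → (IsStart i → V (size i) ≡ 0ℤ) → slimesAtℤ f i V ≡ 0ℤ
  slimesAtℤ-start i V vanish with atMax⊎belowMax f (prev i) | atMax⊎belowMax f i
  ... | inj₁ prev-at     | _           = slimesAtℤ-notStart f i (inj₁ prev-at) V
  ... | inj₂ _           | inj₂ below  = slimesAtℤ-notStart f i (inj₂ below) V
  ... | inj₂ prev-below  | inj₁ at     =
    trans (slimesAtℤ-run (run-spec i) prev-below (atMax⇒1≤run i at) V) (vanish (isStart i prev-below at))

  moveAt-outside : ∀ c q i → (∀ t → t ≤ run i → pos i t ≢ q) → moveAt c q i (size i) ≡ 0ℤ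
  moveAt-outside c q i miss = sumℤ-upTo-0 (λ t → if does (pos i t ≟ᶠ q) then c (size i) t else 0ℤ) id (size i)
    (λ t t<size → cong (λ z → if z then c (size i) t else 0ℤ) (dec-false (pos i t ≟ᶠ q) (miss t (≤-pred t<size))))

  moveAt-inside : ∀ c i t → t ≤ run i → moveAt c (pos i t) i (size i) ≡ c (size i) t
  moveAt-inside c i t t≤run =
    trans (sumℤ-upTo-single (λ j → if does (pos i j ≟ᶠ pos i t) then c (size i) j else 0ℤ) id (size i) t (s≤s t≤run) others)
          (cong (λ z → if z then c (size i) t else 0ℤ) (dec-true (pos i t ≟ᶠ pos i t) refl))
    where
      run<n = Run.k<n (run-spec i)
      others : ∀ j → j < size i → j ≢ t → (if does (pos i j ≟ᶠ pos i t) then c (size i) j else 0ℤ) ≡ 0ℤ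
      others j j<size j≢t = cong (λ z → if z then c (size i) j else 0ℤ)
        (dec-false (pos i j ≟ᶠ pos i t) (j≢t ∘′ pos-injective i (<-≤-trans j<size run<n) (≤-<-trans t≤run run<n)))

  delta-inside : ∀ c {i} t → IsStart i → t ≤ run i → delta c f (pos i t) ≡ c (size i) t
  delta-inside c {i} t st t≤run = begin
    delta c f (pos i t)                 ≡⟨ sumℤ-allFin-single (λ i′ → slimesAtℤ f i′ (moveAt c (pos i t) i′)) n id i others ⟩
    slimesAtℤ f i (moveAt c (pos i t) i) ≡⟨ slimesAtℤ-run (run-spec i) (IsStart.before st) (IsStart.1≤run st) _ ⟩
    moveAt c (pos i t) i (size i)        ≡⟨ moveAt-inside c i t t≤run ⟩
    c (size i) t                         ∎
    where
      open ≡-Reasoning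
      others : ∀ i′ → i′ ≢ i → slimesAtℤ f i′ (moveAt c (pos i t) i′) ≡ 0ℤ
      others i′ i′≢i = slimesAtℤ-start i′ _ λ st′ →
        moveAt-outside c (pos i t) i′ (λ t′ t′≤ e → i′≢i (start-unique t′ t st′ st t′≤ t≤run e))

  delta-outside : ∀ c q → BelowMax f (prev q) → BelowMax f q → delta c f q ≡ 0ℤ
  delta-outside c q prev-below below = sumℤ-allFin-0 (λ i → slimesAtℤ f i (moveAt c q i)) n id
    (λ i → slimesAtℤ-start i (moveAt c q i) (λ st → moveAt-outside c q i (miss i st)))
    where
      miss : ∀ i → IsStart i → ∀ t → t ≤ run i → pos i t ≢ q
      miss i st zero    _     e = ≡-<-absurd (subst (AtMax f) (trans (pos-0 i) (trans (sym (pos-0 i)) e)) (run-atMax 0 (IsStart.1≤run st))) below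
      miss i st (suc t) t<run e = ≡-<-absurd (subst (AtMax f) (trans (sym (prev-pos-suc i t)) (cong prev e)) (run-atMax t t<run)) prev-below

  EndsAt : Fin n → Set
  EndsAt r = ∃ λ i → IsStart i × pos i (run i) ≡ r

  slime-ending-at : ∀ r → BelowMax f r → AtMax f (prev r) → EndsAt r
  slime-ending-at r below prev-at = ends (atMax⇒inSlime (prev r) prev-at)
    where
      ends : InSlime (prev r) → EndsAt r
      ends (i , t , st , t<run , i+t≡r-1) = i , st , trans (cong (pos i) (sym 1+t≡run)) i+1+t≡r
        where
          i+1+t≡r : pos i (suc t) ≡ r
          i+1+t≡r = trans (pos-sucʳ i t) (trans (cong next i+t≡r-1) (next-prev r))
          1+t≡run : suc t ≡ run i
          1+t≡run with m≤n⇒m<n∨m≡n t<run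
          ... | inj₁ 1+t<run = ≡-<-absurd (subst (AtMax f) i+1+t≡r (run-atMax {i} (suc t) 1+t<run)) below
          ... | inj₂ 1+t≡run = 1+t≡run

  delta-belowMax : ∀ c r → BelowMax f r →
    delta c f r ≡ 0ℤ ⊎ (∃ λ i → IsStart i × delta c f r ≡ c (size i) (run i))
  delta-belowMax c r below with atMax⊎belowMax f (prev r)
  ... | inj₂ prev-below = inj₁ (delta-outside c r prev-below below)
  ... | inj₁ prev-at =
    let i , st , end≡r = slime-ending-at r below prev-at
    in  inj₂ (i , st , trans (cong (delta c f) (sym end≡r)) (delta-inside c (run i) st ≤-refl))

  delta-next-belowMax : ∀ c r → BelowMax f r →
    delta c f (next r) ≡ 0ℤ ⊎ (IsStart (next r) × delta c f (next r) ≡ c (size (next r)) 0)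
  delta-next-belowMax c r below with atMax⊎belowMax f (next r)
  ... | inj₂ next-below = inj₁ (delta-outside c (next r) (subst (BelowMax f) (sym (prev-next r)) below) next-below)
  ... | inj₁ next-at = inj₂ (st , trans (cong (delta c f) (sym (pos-0 (next r)))) (delta-inside c 0 st z≤n))
    where st = isStart (next r) (subst (BelowMax f) (sym (prev-next r)) below) next-at

  move : (ℕ → ℕ → ℤ) → Conf n
  move c p = f p ℤ.+ delta c f p

  pairSum-move : ∀ c r → pairSum (move c) r ≡ pairSum f r ℤ.+ (delta c f r ℤ.+ delta c f (next r))
  pairSum-move c r = ℤ-interchange (f r) (delta c f r) (f (next r)) (delta c f (next r))

  pairSum-move-inside : ∀ c {i} j → IsStart i → j < run i →
    pairSum (move c) (pos i j) ≡ pairSum f (pos i j) ℤ.+ (c (size i) j ℤ.+ c (size i) (suc j))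
  pairSum-move-inside c {i} j st j<run = trans (pairSum-move c (pos i j)) (cong (λ d → pairSum f (pos i j) ℤ.+ d)
    (cong₂ ℤ._+_ (delta-inside c j st (<⇒≤ j<run)) (trans (cong (delta c f) (sym (pos-sucʳ i j))) (delta-inside c (suc j) st j<run))))

half evenHalf oddHalf : ℕ → ℕ
half     l = l / 2
evenHalf l = if even l then l / 2 else 0
oddHalf  l = if even l then 0 else l / 2

half≡evenHalf+oddHalf : ∀ l → half l ≡ evenHalf l + oddHalf l
half≡evenHalf+oddHalf l with even l
... | true  = sym (+-identityʳ _)
... | false = refl

evenHalf-even : ∀ l → even l ≡ true → evenHalf l ≡ l / 2
evenHalf-even l e rewrite e = refl

evenHalf-odd : ∀ l → even l ≡ false → evenHalf l ≡ 0
evenHalf-odd l e rewrite e = refl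

oddHalf-even : ∀ l → even l ≡ true → oddHalf l ≡ 0
oddHalf-even l e rewrite e = refl

oddHalf-odd : ∀ l → even l ≡ false → oddHalf l ≡ l / 2
oddHalf-odd l e rewrite e = refl

module Forward (n : ℕ) .{{_ : NonZero n}} (f : Conf n) (b : Fin n) (b-below : Slimes.BelowMax n f b) where
  open CyclicPositions n
  open Slimes n
  open SlimeDecomposition n f b b-below

  g : Conf n
  g = move fwdCoeff

  δ : Fin n → ℤ
  δ = delta fwdCoeff f

  inside-stays : ∀ {i} j → IsStart i → j < run i → 1 ≤ j ⊎ even (size i) ≡ true → pairSum g (pos i j) ≡ M
  inside-stays {i} (suc j) st j<run _ = trans (pairSum-move-inside fwdCoeff (suc j) st j<run)
    (x≡m∧d≡0⇒x+d≡m (run-atMax (suc j) j<run) (fwdCoeff-cancel (size i) j))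
  inside-stays {i} zero st 0<run (inj₂ ev) = trans (pairSum-move-inside fwdCoeff 0 st 0<run)
    (x≡m∧d≡0⇒x+d≡m (run-atMax 0 0<run) (fwdCoeff-first-even (size i) ev))

  first-drops-odd : ∀ {i} → IsStart i → even (size i) ≡ false → pairSum g i ℤ.< M
  first-drops-odd {i} st odd = subst (λ z → pairSum g z ℤ.< M) (pos-0 i)
    (subst (ℤ._< M) (sym (pairSum-move-inside fwdCoeff 0 st (IsStart.1≤run st)))
      (x≡m∧d≡-1⇒x+d<m (run-atMax 0 (IsStart.1≤run st)) (fwdCoeff-first-odd (size i) odd)))

  δ-next≤0 : ∀ r → BelowMax f r → δ (next r) ℤ.≤ 0ℤ
  δ-next≤0 r below with delta-next-belowMax fwdCoeff r below
  ... | inj₁ δ≡0      = ℤP.≤-reflexive δ≡0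
  ... | inj₂ (_ , δ≡) = ℤP.≤-trans (ℤP.≤-reflexive δ≡) (fwdCoeff-0≤0 (size (next r)))

  δ≤1 : ∀ r → BelowMax f r → δ r ℤ.≤ 1ℤ
  δ≤1 r below with delta-belowMax fwdCoeff r below
  ... | inj₁ δ≡0           = ℤP.≤-trans (ℤP.≤-reflexive δ≡0) (ℤ.+≤+ z≤n)
  ... | inj₂ (i , st , δ≡) = ℤP.≤-reflexive (trans δ≡ (fwdCoeff-last (run i) (IsStart.1≤run st)))

  gap-stays-below : ∀ r → BelowMax f r → BelowMax f (prev r) → pairSum g r ℤ.< M
  gap-stays-below r below prev-below = subst (ℤ._< M) (sym (pairSum-move fwdCoeff r))
    (x<m∧d≤0⇒x+d<m below (subst (ℤ._≤ 0ℤ) (cong (ℤ._+ δ (next r)) (sym (delta-outside fwdCoeff r prev-below below)))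
                                            (subst (ℤ._≤ 0ℤ) (sym (ℤP.+-identityˡ _)) (δ-next≤0 r below))))

  before-drops-even : ∀ {i} → IsStart i → even (size i) ≡ true → pairSum g (prev i) ℤ.< M
  before-drops-even {i} st ev = subst (ℤ._< M) (sym (pairSum-move fwdCoeff (prev i)))
    (x<m∧d≤0⇒x+d<m (IsStart.before st) (subst (λ z → δ (prev i) ℤ.+ z ℤ.≤ 0ℤ) (sym δ-first)
      (ℤP.+-monoˡ-≤ -1ℤ (δ≤1 (prev i) (IsStart.before st)))))
    where
      δ-first : δ (next (prev i)) ≡ -1ℤ
      δ-first = trans (cong δ (trans (next-prev i) (sym (pos-0 i))))
                      (trans (delta-inside fwdCoeff 0 st z≤n) (fwdCoeff-0-even (size i) ev))

  pairSum-g≤M : ∀ r → pairSum g r ℤ.≤ M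
  pairSum-g≤M r with atMax⊎belowMax f r
  ... | inj₂ below = subst (ℤ._≤ M) (sym (pairSum-move fwdCoeff r))
    (x<m∧d≤1⇒x+d≤m below (ℤP.+-mono-≤ (δ≤1 r below) (δ-next≤0 r below)))
  ... | inj₁ at = in-slime (atMax⇒inSlime r at)
    where
      in-slime : InSlime r → pairSum g r ℤ.≤ M
      in-slime (i , t , st , t<run , i+t≡r) = subst (λ z → pairSum g z ℤ.≤ M) i+t≡r
        (subst (ℤ._≤ M) (sym (pairSum-move-inside fwdCoeff t st t<run))
          (x≡m∧d≤0⇒x+d≤m (run-atMax t t<run) (fwdCoeff-pair≤0 (size i) t)))

  pairSum-g-attained : ∃ λ r → pairSum g r ≡ M
  pairSum-g-attained = in-slime (atMax⇒inSlime _ (proj₂ (maxPair-attained f)))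
    where
      in-slime : ∀ {r} → InSlime r → ∃ λ r → pairSum g r ≡ M
      in-slime (i , suc t , st , t<run , _) = pos i (suc t) , inside-stays (suc t) st t<run (inj₁ (s≤s z≤n))
      in-slime (i , zero  , st , 0<run , _) with parity (size i)
      ... | inj₁ ev  = pos i 0 , inside-stays 0 st 0<run (inj₂ ev)
      ... | inj₂ odd = pos i 1 , inside-stays 1 st (odd-suc⇒2≤ (run i) odd (IsStart.1≤run st)) (inj₁ (s≤s z≤n))

  maxPair-g : maxPair g ≡ M
  maxPair-g = maxPair-unique g M pairSum-g≤M (proj₁ pairSum-g-attained) (proj₂ pairSum-g-attained)

  g-atMax : ∀ {r} → pairSum g r ≡ M → AtMax g r
  g-atMax p≡M = trans p≡M (sym maxPair-g)

  g-belowMax : ∀ {r} → pairSum g r ℤ.< M → BelowMax g r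
  g-belowMax {r} p<M = subst (pairSum g r ℤ.<_) (sym maxPair-g) p<M

  private
    after-start-below : ∀ {r} → IsStart (next r) → AtMax g r → BelowMax g (next r)
    after-start-below {r} st at-g with parity (size (next r))
    ... | inj₁ ev  = ≡-<-absurd (trans at-g maxPair-g) (subst (λ z → pairSum g z ℤ.< M) (prev-next r) (before-drops-even st ev))
    ... | inj₂ odd = g-belowMax (first-drops-odd st odd)

  after-end-below : ∀ r → BelowMax f r → AtMax g r → BelowMax g (next r)
  after-end-below r below at-g with atMax⊎belowMax f (next r)
  ... | inj₁ next-at    = after-start-below (isStart (next r) (subst (BelowMax f) (sym (prev-next r)) below) next-at) at-g
  ... | inj₂ next-below = g-belowMax (gap-stays-below (next r) next-below (subst (BelowMax f) (sym (prev-next r)) below))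

  -- The slime of g starting at i either stops where the run of f stopped or absorbs that one extra pair.
  weight-g-from : ∀ i m → 1 ≤ m → m < n → BelowMax g (prev i) → (∀ j → j < m → AtMax g (pos i j)) → BelowMax f (pos i m) →
    slimesAtℕ g i half ≡ suc m / 2 ⊎ slimesAtℕ g i half ≡ suc (suc m) / 2
  weight-g-from i m 1≤m m<n before inside end with atMax⊎belowMax g (pos i m)
  ... | inj₂ end-g = inj₁ (slimesAtℕ-run run-g before 1≤m half)
    where
      run-g : Run g i m
      run-g = record { k<n = m<n ; inside = inside ; end = end-g }
  ... | inj₁ at-g  = inj₂ (slimesAtℕ-run run-g before (≤-trans 1≤m (n≤1+n m)) half)
    where
      1+m<n : suc m < n
      1+m<n with m≤n⇒m<n∨m≡n m<n
      ... | inj₁ 1+m<n = 1+m<n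
      ... | inj₂ 1+m≡n = ≡-<-absurd at-g (subst (BelowMax g) (sym (cong (pos i) (trans (sym (m+n∸m≡n 1 m)) (cong (_∸ 1) 1+m≡n)))) before)
      inside′ : ∀ j → j < suc m → AtMax g (pos i j)
      inside′ j j<1+m with m≤n⇒m<n∨m≡n (≤-pred j<1+m)
      ... | inj₁ j<m  = inside j j<m
      ... | inj₂ refl = at-g
      end′ : BelowMax g (pos i (suc m))
      end′ = subst (BelowMax g) (sym (pos-sucʳ i m)) (after-end-below (pos i m) end at-g)
      run-g : Run g i (suc m)
      run-g = record { k<n = 1+m<n ; inside = inside′ ; end = end′ }

  weight-g-at-start : ∀ {i} → IsStart i → slimesAtℕ g i half ≡ evenHalf (size i)
  weight-g-at-start {i} st with parity (size i)
  ... | inj₂ odd = trans (slimesAtℕ-notStart g i (inj₂ (g-belowMax (first-drops-odd st odd))) half) (sym (evenHalf-odd (size i) odd))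
  ... | inj₁ ev  = trans w (sym (evenHalf-even (size i) ev))
    where
      w : slimesAtℕ g i half ≡ size i / 2
      w = [ id , (λ w → trans w (even⇒[1+t]/2≡t/2 (size i) ev)) ]′
        (weight-g-from i (run i) (IsStart.1≤run st) (Run.k<n (run-spec i)) (g-belowMax (before-drops-even st ev))
                       (λ j j<run → g-atMax (inside-stays j st j<run (inj₂ ev))) (run-end i))

  weight-g-after-start : ∀ {i} → IsStart (prev i) → slimesAtℕ g i half ≡ oddHalf (size (prev i))
  weight-g-after-start {i} st with parity (size (prev i))
  ... | inj₁ ev  = trans (slimesAtℕ-notStart g i (inj₁ (g-atMax (subst (λ z → pairSum g z ≡ M) (pos-0 (prev i)) (inside-stays 0 st (IsStart.1≤run st) (inj₂ ev))))) half)
                         (sym (oddHalf-even (size (prev i)) ev))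
  ... | inj₂ odd = trans w (sym (oddHalf-odd (size (prev i)) odd))
    where
      s = prev i
      k = run s
      m = k ∸ 1
      1+m≡k : suc m ≡ k
      1+m≡k = m+[n∸m]≡n (IsStart.1≤run st)
      shift : ∀ j → pos i j ≡ pos s (suc j)
      shift j = trans (cong (λ z → pos z j) (sym (next-prev i))) (sym (pos-suc s j))
      inside : ∀ j → j < m → AtMax g (pos i j)
      inside j j<m = g-atMax (subst (λ z → pairSum g z ≡ M) (sym (shift j))
        (inside-stays (suc j) st (subst (suc (suc j) ≤_) 1+m≡k (s≤s j<m)) (inj₁ (s≤s z≤n))))
      end : BelowMax f (pos i m)
      end = subst (BelowMax f) (sym (trans (shift m) (cong (pos s) 1+m≡k))) (run-end s)
      w : slimesAtℕ g i half ≡ size s / 2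
      w = [ (λ w → trans w (trans (cong half 1+m≡k) (sym (even⇒[1+t]/2≡t/2 k (even-pred k odd))))) ,
                 (λ w → trans w (cong (λ z → suc z / 2) 1+m≡k)) ]′
        (weight-g-from i m (∸-monoˡ-≤ 1 (odd-suc⇒2≤ k odd (IsStart.1≤run st))) (≤-<-trans (m∸n≤m k 1) (Run.k<n (run-spec s)))
                       (g-belowMax (first-drops-odd st odd)) inside end)

  interior-stays : ∀ r → AtMax f (prev r) → AtMax f r → pairSum g r ≡ M
  interior-stays r prev-at at = in-slime (atMax⇒inSlime r at)
    where
      in-slime : InSlime r → pairSum g r ≡ M
      in-slime (i , zero  , st , _ , i≡r) = ≡-<-absurd prev-at (subst (λ z → BelowMax f (prev z)) (trans (sym (pos-0 i)) i≡r) (IsStart.before st))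
      in-slime (i , suc t , st , t<run , i+t≡r) = subst (λ z → pairSum g z ≡ M) i+t≡r (inside-stays (suc t) st t<run (inj₁ (s≤s z≤n)))

  weight-g-at : ∀ i → slimesAtℕ g i half ≡ slimesAtℕ f i evenHalf + slimesAtℕ f (prev i) oddHalf
  weight-g-at i with atMax⊎belowMax f (prev i) | atMax⊎belowMax f i
  ... | inj₂ prev-below | inj₂ below = trans (slimesAtℕ-notStart g i (inj₂ (g-belowMax (gap-stays-below i below prev-below))) half)
    (sym (cong₂ _+_ (slimesAtℕ-notStart f i (inj₂ below) evenHalf) (slimesAtℕ-notStart f (prev i) (inj₂ prev-below) oddHalf)))
  ... | inj₂ prev-below | inj₁ at = trans (weight-g-at-start st) (sym (trans
    (cong₂ _+_ (slimesAtℕ-run (run-spec i) prev-below (IsStart.1≤run st) evenHalf) (slimesAtℕ-notStart f (prev i) (inj₂ prev-below) oddHalf))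
    (+-identityʳ _)))
    where st = isStart i prev-below at
  ... | inj₁ prev-at | _ with atMax⊎belowMax f (prev (prev i))
  ...   | inj₁ prev²-at = trans (slimesAtℕ-notStart g i (inj₁ (g-atMax (interior-stays (prev i) prev²-at prev-at))) half)
    (sym (cong₂ _+_ (slimesAtℕ-notStart f i (inj₁ prev-at) evenHalf) (slimesAtℕ-notStart f (prev i) (inj₁ prev²-at) oddHalf)))
  ...   | inj₂ prev²-below = trans (weight-g-after-start st)
    (sym (cong₂ _+_ (slimesAtℕ-notStart f i (inj₁ prev-at) evenHalf) (slimesAtℕ-run (run-spec (prev i)) prev²-below (IsStart.1≤run st) oddHalf)))
    where st = isStart (prev i) prev²-below prev-at

  weight-preserved : weight f ≡ weight g
  weight-preserved = sym (begin
    sum (map (λ i → slimesAtℕ g i half) (allFin n))                                         ≡⟨ cong sum (map-cong weight-g-at (allFin n)) ⟩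
    sum (map (λ i → slimesAtℕ f i evenHalf + slimesAtℕ f (prev i) oddHalf) (allFin n))      ≡⟨ sum-allFin-reindex n prev (sum-allFin-prev n) (λ i → slimesAtℕ f i evenHalf) (λ i → slimesAtℕ f i oddHalf) ⟩
    sum (map (λ i → slimesAtℕ f i evenHalf + slimesAtℕ f i oddHalf) (allFin n))            ≡⟨ cong sum (map-cong (λ i → slimesAtℕ-split f i half evenHalf oddHalf half≡evenHalf+oddHalf) (allFin n)) ⟨
    sum (map (λ i → slimesAtℕ f i half) (allFin n))                                         ∎)
    where open ≡-Reasoning

module Backward (n : ℕ) .{{_ : NonZero n}} (f : Conf n) (b : Fin n) (b-below : Slimes.BelowMax n f b) where
  open CyclicPositions n
  open Slimes n
  open SlimeDecomposition n f b b-below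

  g : Conf n
  g = move bwdCoeff

  δ : Fin n → ℤ
  δ = delta bwdCoeff f

  inside-stays : ∀ {i} j → IsStart i → j < run i → suc j < run i ⊎ even (size i) ≡ true → pairSum g (pos i j) ≡ M
  inside-stays {i} j st j<run c = trans (pairSum-move-inside bwdCoeff j st j<run)
    (x≡m∧d≡0⇒x+d≡m (run-atMax j j<run) (bwdCoeff-cancel (run i) j c))

  last-drops-odd : ∀ {i} → IsStart i → even (size i) ≡ false → pairSum g (pos i (run i ∸ 1)) ℤ.< M
  last-drops-odd {i} st odd = subst (ℤ._< M) (sym (pairSum-move-inside bwdCoeff (run i ∸ 1) st k-1<k))
    (x≡m∧d≡-1⇒x+d<m (run-atMax (run i ∸ 1) k-1<k)
      (trans (cong (λ z → bwdCoeff (size i) (run i ∸ 1) ℤ.+ bwdCoeff (size i) z) 1+[k-1]≡k)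
             (bwdCoeff-last-pair-odd (run i) odd (odd-suc⇒2≤ (run i) odd (IsStart.1≤run st)))))
    where
      1+[k-1]≡k : suc (run i ∸ 1) ≡ run i
      1+[k-1]≡k = m+[n∸m]≡n (IsStart.1≤run st)
      k-1<k : run i ∸ 1 < run i
      k-1<k = subst (run i ∸ 1 <_) 1+[k-1]≡k ≤-refl

  δ-next≤1 : ∀ r → BelowMax f r → δ (next r) ℤ.≤ 1ℤ
  δ-next≤1 r below with delta-next-belowMax bwdCoeff r below
  ... | inj₁ δ≡0       = ℤP.≤-trans (ℤP.≤-reflexive δ≡0) (ℤ.+≤+ z≤n)
  ... | inj₂ (st , δ≡) = ℤP.≤-reflexive (trans δ≡ (bwdCoeff-0 (run (next r)) (IsStart.1≤run st)))

  δ≤0 : ∀ r → BelowMax f r → δ r ℤ.≤ 0ℤ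
  δ≤0 r below with delta-belowMax bwdCoeff r below
  ... | inj₁ δ≡0           = ℤP.≤-reflexive δ≡0
  ... | inj₂ (i , st , δ≡) = ℤP.≤-trans (ℤP.≤-reflexive δ≡) (bwdCoeff-last≤0 (run i))

  end-drops-even : ∀ {i} → IsStart i → even (size i) ≡ true → pairSum g (pos i (run i)) ℤ.< M
  end-drops-even {i} st ev = subst (ℤ._< M) (sym (pairSum-move bwdCoeff r))
    (x<m∧d≤0⇒x+d<m (run-end i) (subst (λ z → z ℤ.+ δ (next r) ℤ.≤ 0ℤ) (sym δ-end)
      (ℤP.+-monoʳ-≤ -1ℤ (δ-next≤1 r (run-end i)))))
    where
      r = pos i (run i)
      δ-end : δ r ≡ -1ℤ
      δ-end = trans (delta-inside bwdCoeff (run i) st ≤-refl) (bwdCoeff-last-even (run i) ev)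

  gap-stays-below : ∀ r → BelowMax f r → BelowMax f (next r) → pairSum g r ℤ.< M
  gap-stays-below r below next-below = subst (ℤ._< M) (sym (pairSum-move bwdCoeff r))
    (x<m∧d≤0⇒x+d<m below (subst (λ z → δ r ℤ.+ z ℤ.≤ 0ℤ)
      (sym (delta-outside bwdCoeff (next r) (subst (BelowMax f) (sym (prev-next r)) below) next-below))
      (subst (ℤ._≤ 0ℤ) (sym (ℤP.+-identityʳ _)) (δ≤0 r below))))

  pairSum-g≤M : ∀ r → pairSum g r ℤ.≤ M
  pairSum-g≤M r with atMax⊎belowMax f r
  ... | inj₂ below = subst (ℤ._≤ M) (sym (pairSum-move bwdCoeff r))
    (x<m∧d≤1⇒x+d≤m below (ℤP.+-mono-≤ (δ≤0 r below) (δ-next≤1 r below)))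
  ... | inj₁ at = in-slime (atMax⇒inSlime r at)
    where
      in-slime : InSlime r → pairSum g r ℤ.≤ M
      in-slime (i , t , st , t<run , i+t≡r) = subst (λ z → pairSum g z ℤ.≤ M) i+t≡r
        (subst (ℤ._≤ M) (sym (pairSum-move-inside bwdCoeff t st t<run))
          (x≡m∧d≤0⇒x+d≤m (run-atMax t t<run) (bwdCoeff-pair≤0 (run i) t t<run)))

  pairSum-g-attained : ∃ λ r → pairSum g r ≡ M
  pairSum-g-attained = in-slime (atMax⇒inSlime _ (proj₂ (maxPair-attained f)))
    where
      in-slime : ∀ {r} → InSlime r → ∃ λ r → pairSum g r ≡ M
      in-slime (i , t , st , t<run , _) with parity (size i)
      ... | inj₁ ev  = pos i t , inside-stays t st t<run (inj₂ ev)
      ... | inj₂ odd = pos i 0 , inside-stays 0 st (IsStart.1≤run st) (inj₁ (odd-suc⇒2≤ (run i) odd (IsStart.1≤run st)))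

  maxPair-g : maxPair g ≡ M
  maxPair-g = maxPair-unique g M pairSum-g≤M (proj₁ pairSum-g-attained) (proj₂ pairSum-g-attained)

  g-atMax : ∀ {r} → pairSum g r ≡ M → AtMax g r
  g-atMax p≡M = trans p≡M (sym maxPair-g)

  g-belowMax : ∀ {r} → pairSum g r ℤ.< M → BelowMax g r
  g-belowMax {r} p<M = subst (pairSum g r ℤ.<_) (sym maxPair-g) p<M

  interior-stays : ∀ r → AtMax f r → AtMax f (next r) → pairSum g r ≡ M
  interior-stays r at next-at = in-slime (atMax⇒inSlime r at)
    where
      in-slime : InSlime r → pairSum g r ≡ M
      in-slime (i , t , st , t<run , i+t≡r) = subst (λ z → pairSum g z ≡ M) i+t≡r
        (inside-stays t st t<run (inj₁ (atMax⇒<run (suc t) t<run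
          (subst (AtMax f) (trans (cong next (sym i+t≡r)) (sym (pos-sucʳ i t))) next-at))))

  before-stays-below : ∀ i → BelowMax f i → AtMax g i → BelowMax g (prev i)
  before-stays-below i below g-at with atMax⊎belowMax f (prev i)
  ... | inj₂ prev-below = g-belowMax (gap-stays-below (prev i) prev-below (subst (BelowMax f) (sym (next-prev i)) below))
  ... | inj₁ prev-at = after-end (slime-ending-at i below prev-at)
    where
      after-end : EndsAt i → BelowMax g (prev i)
      after-end (s , st , end≡i) with parity (size s)
      ... | inj₁ ev  = ≡-<-absurd (trans g-at maxPair-g) (subst (λ z → pairSum g z ℤ.< M) end≡i (end-drops-even st ev))
      ... | inj₂ odd = g-belowMax (subst (λ z → pairSum g z ℤ.< M) last≡prev (last-drops-odd st odd))
        where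
          last≡prev : pos s (run s ∸ 1) ≡ prev i
          last≡prev = trans (sym (prev-pos-suc s (run s ∸ 1))) (cong prev (trans (cong (pos s) (m+[n∸m]≡n (IsStart.1≤run st))) end≡i))

  weight-g-at-start : ∀ {i} → IsStart i → BelowMax g (prev i) → slimesAtℕ g i half ≡ size i / 2
  weight-g-at-start {i} st before with parity (size i)
  ... | inj₁ ev = slimesAtℕ-run run-g before (IsStart.1≤run st) half
    where
      run-g : Run g i (run i)
      run-g = record
        { k<n    = Run.k<n (run-spec i)
        ; inside = λ j j<run → g-atMax (inside-stays j st j<run (inj₂ ev))
        ; end    = g-belowMax (end-drops-even st ev) }
  ... | inj₂ odd = trans (slimesAtℕ-run run-g before (∸-monoˡ-≤ 1 (odd-suc⇒2≤ k odd (IsStart.1≤run st))) half)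
                         (trans (cong half 1+m≡k) (sym (even⇒[1+t]/2≡t/2 k (even-pred k odd))))
    where
      k = run i
      1+m≡k : suc (k ∸ 1) ≡ k
      1+m≡k = m+[n∸m]≡n (IsStart.1≤run st)
      run-g : Run g i (k ∸ 1)
      run-g = record
        { k<n    = ≤-<-trans (m∸n≤m k 1) (Run.k<n (run-spec i))
        ; inside = λ j j<m → g-atMax (inside-stays j st (<-≤-trans j<m (m∸n≤m k 1)) (inj₁ (subst (suc (suc j) ≤_) 1+m≡k (s≤s j<m))))
        ; end    = g-belowMax (last-drops-odd st odd) }

  weight-g-before-start : ∀ {i} → IsStart (next i) → AtMax g i → BelowMax g (prev i) → slimesAtℕ g i half ≡ size (next i) / 2
  weight-g-before-start {i} st g-at before with parity (size (next i))
  ... | inj₁ ev = trans (slimesAtℕ-run run-g before (s≤s z≤n) half) (even⇒[1+t]/2≡t/2 (size s) ev)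
    where
      s = next i
      k = run s
      end : BelowMax g (pos i (suc k))
      end = subst (BelowMax g) (sym (pos-suc i k)) (g-belowMax (end-drops-even st ev))
      1+k<n : suc k < n
      1+k<n with m≤n⇒m<n∨m≡n (Run.k<n (run-spec s))
      ... | inj₁ 1+k<n = 1+k<n
      ... | inj₂ 1+k≡n = ≡-<-absurd g-at (subst (BelowMax g) (trans (cong (pos i) 1+k≡n) (pos-n i)) end)
      inside : ∀ j → j < suc k → AtMax g (pos i j)
      inside zero    _         = subst (AtMax g) (sym (pos-0 i)) g-at
      inside (suc j) (s≤s j<k) = subst (AtMax g) (sym (pos-suc i j)) (g-atMax (inside-stays j st j<k (inj₂ ev)))
      run-g : Run g i (suc k)
      run-g = record { k<n = 1+k<n ; inside = inside ; end = end }
  ... | inj₂ odd = slimesAtℕ-run run-g before (IsStart.1≤run st) half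
    where
      s = next i
      k = run s
      inside : ∀ j → j < k → AtMax g (pos i j)
      inside zero    _     = subst (AtMax g) (sym (pos-0 i)) g-at
      inside (suc j) 1+j<k = subst (AtMax g) (sym (pos-suc i j)) (g-atMax (inside-stays j st (<-trans (n<1+n j) 1+j<k) (inj₁ 1+j<k)))
      end : BelowMax g (pos i k)
      end = subst (BelowMax g) (trans (sym (pos-suc i (k ∸ 1))) (cong (pos i) (m+[n∸m]≡n (IsStart.1≤run st))))
                  (g-belowMax (last-drops-odd st odd))
      run-g : Run g i k
      run-g = record { k<n = Run.k<n (run-spec s) ; inside = inside ; end = end }

  -- The slime of f starting at i becomes the slime of g starting at i, or at prev i exactly
  -- when the pair at prev i reaches the maximum.
  shifted? : ∀ i → Dec (AtMax g (prev i))
  shifted? i = pairSum g (prev i) ℤP.≟ maxPair g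

  stays shifts : Fin n → ℕ
  stays  i = if does (shifted? i) then 0 else slimesAtℕ f i half
  shifts i = if does (shifted? i) then slimesAtℕ f i half else 0

  weight-f-split : ∀ i → slimesAtℕ f i half ≡ stays i + shifts i
  weight-f-split i with does (shifted? i)
  ... | true  = refl
  ... | false = sym (+-identityʳ _)

  stays-notStart : ∀ i → NotStart f i → stays i ≡ 0
  stays-notStart i ns with does (shifted? i)
  ... | true  = refl
  ... | false = slimesAtℕ-notStart f i ns half

  shifts-notStart : ∀ i → NotStart f i → shifts i ≡ 0
  shifts-notStart i ns with does (shifted? i)
  ... | true  = slimesAtℕ-notStart f i ns half
  ... | false = refl

  stays-shifted : ∀ {i} → AtMax g (prev i) → stays i ≡ 0
  stays-shifted {i} at = cong (λ z → if z then 0 else slimesAtℕ f i half) (dec-true (shifted? i) at)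

  shifts-shifted : ∀ {i} → AtMax g (prev i) → shifts i ≡ slimesAtℕ f i half
  shifts-shifted {i} at = cong (λ z → if z then slimesAtℕ f i half else 0) (dec-true (shifted? i) at)

  stays-unshifted : ∀ {i} → BelowMax g (prev i) → stays i ≡ slimesAtℕ f i half
  stays-unshifted {i} below = cong (λ z → if z then 0 else slimesAtℕ f i half) (dec-false (shifted? i) (λ at → ≡-<-absurd at below))

  shifts-unshifted : ∀ {i} → BelowMax g (prev i) → shifts i ≡ 0
  shifts-unshifted {i} below = cong (λ z → if z then slimesAtℕ f i half else 0) (dec-false (shifted? i) (λ at → ≡-<-absurd at below))

  weight-g-at : ∀ i → slimesAtℕ g i half ≡ stays i + shifts (next i)
  weight-g-at i with atMax⊎belowMax f i
  weight-g-at i | inj₁ at with atMax⊎belowMax f (prev i)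
  ... | inj₁ prev-at = trans (slimesAtℕ-notStart g i (inj₁ (g-atMax (interior-stays (prev i) prev-at (subst (AtMax f) (sym (next-prev i)) at)))) half)
    (sym (cong₂ _+_ (stays-notStart i (inj₁ prev-at)) (shifts-notStart (next i) (atMax⇒notStart-next f i at))))
  ... | inj₂ prev-below with atMax⊎belowMax g (prev i)
  ...   | inj₁ g-prev-at = trans (slimesAtℕ-notStart g i (inj₁ g-prev-at) half)
    (sym (cong₂ _+_ (stays-shifted g-prev-at) (shifts-notStart (next i) (atMax⇒notStart-next f i at))))
  ...   | inj₂ g-prev-below = trans (weight-g-at-start st g-prev-below) (sym (trans
    (cong₂ _+_ (stays-unshifted g-prev-below) (shifts-notStart (next i) (atMax⇒notStart-next f i at)))
    (trans (+-identityʳ _) (slimesAtℕ-run (run-spec i) prev-below (IsStart.1≤run st) half))))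
    where st = isStart i prev-below at
  weight-g-at i | inj₂ below with atMax⊎belowMax f (next i)
  ... | inj₂ next-below = trans (slimesAtℕ-notStart g i (inj₂ (g-belowMax (gap-stays-below i below next-below))) half)
    (sym (cong₂ _+_ (stays-notStart i (inj₂ below)) (shifts-notStart (next i) (inj₂ next-below))))
  ... | inj₁ next-at with atMax⊎belowMax g i
  ...   | inj₂ g-below = trans (slimesAtℕ-notStart g i (inj₂ g-below) half)
    (sym (cong₂ _+_ (stays-notStart i (inj₂ below)) (shifts-unshifted (subst (BelowMax g) (sym (prev-next i)) g-below))))
  ...   | inj₁ g-at = trans (weight-g-before-start st g-at (before-stays-below i below g-at)) (sym
    (cong₂ _+_ (stays-notStart i (inj₂ below))
               (trans (shifts-shifted (subst (AtMax g) (sym (prev-next i)) g-at))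
                      (slimesAtℕ-run (run-spec (next i)) (IsStart.before st) (IsStart.1≤run st) half))))
    where st = isStart (next i) (subst (BelowMax f) (sym (prev-next i)) below) next-at

  weight-preserved : weight g ≡ weight f
  weight-preserved = begin
    sum (map (λ i → slimesAtℕ g i half) (allFin n))        ≡⟨ cong sum (map-cong weight-g-at (allFin n)) ⟩
    sum (map (λ i → stays i + shifts (next i)) (allFin n)) ≡⟨ sum-allFin-reindex n next (sum-allFin-next n) stays shifts ⟩
    sum (map (λ i → stays i + shifts i) (allFin n))        ≡⟨ cong sum (map-cong weight-f-split (allFin n)) ⟨
    sum (map (λ i → slimesAtℕ f i half) (allFin n))        ∎
    where open ≡-Reasoning

valid⇒belowMax : ∀ {n} .{{_ : NonZero n}} (h : Conf n) → Valid h → ∃ (Slimes.BelowMax n h)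
valid⇒belowMax {n} h valid with ¬∀⟶∃¬ n (λ i → pairSum h i ≡ maxPair h) (λ i → pairSum h i ℤP.≟ maxPair h) valid
... | b , ¬at = b , Slimes.¬atMax⇒belowMax n h ¬at

weight-φ← : ∀ {n} .{{_ : NonZero n}} (h : Conf n) → Valid h → weight (φ← h) ≡ weight h
weight-φ← {n} h valid = Backward.weight-preserved n h (proj₁ below) (proj₂ below)
  where below = valid⇒belowMax h valid

weight-φ→ : ∀ {n} .{{_ : NonZero n}} (h : Conf n) → Valid h → weight h ≡ weight (φ→ h)
weight-φ→ {n} h valid = Forward.weight-preserved n h (proj₁ below) (proj₂ below)
  where below = valid⇒belowMax h valid

lemma2p3 : (n k : ℕ) → .{{_ : NonZero n}} → 0 < k → (f : Fin n → ℕ) → IsCode n k f → Valid (toConf f)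
    → (weight (φ← (toConf f)) ≡ weight (toConf f)) × (weight (toConf f) ≡ weight (φ→ (toConf f)))
lemma2p3 n k _ f _ valid = weight-φ← (toConf f) valid , weight-φ→ (toConf f) valid
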